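{- Let $G$ be a finite bipartite cactus graph and $v$ a vertex of $G$. Let $k=\max_{u\in V(G)} d(v,u)$ and for $i=0,\dots,k$ let $V_i=\{u\in V(G): d(v,u)=i\}$. Then: (1) if $1\le i\le k$ and $x\in V_i$, then $x$ has at most two neighbours in $V_{i-1}$; (2) if $1\le i\le k-1$ and $x\in V_i$, then there is at most one vertex $y\in V_i$, $y\neq x$, such that $x$ and $y$ have a common neighbour in $V_{i+1}$; moreover, if such a $y$ exists, then $x$ has exactly one neighbour in $V_{i-1}$.
   Context: A cactus graph is a connected graph in which any two distinct cycles share at most one vertex. $d(v,u)$ denotes the distance between $v$ and $u$ in $G$. -}

module Defs where

open import Data.Nat using (ℕ; zero; suc; _+_; _≤_; _<?_; s≤s)
open import Data.Fin using (Fin; toℕ; fromℕ<) renaming (zero to fzero)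
open import Data.Bool using (Bool; true; false)
open import Data.Product using (Σ; ∃; _×_; _,_)
open import Data.Sum using (_⊎_)
open import Relation.Nullary using (¬_; yes; no)
open import Relation.Binary.PropositionalEquality using (_≡_; _≢_)

record Graph (n : ℕ) : Set where
  field
    adj   : Fin n → Fin n → Bool
    sym   : ∀ x y → adj x y ≡ adj y x
    irrefl : ∀ x → adj x x ≡ false

open Graph public

Adj : ∀ {n} → Graph n → Fin n → Fin n → Set
Adj G x y = adj G x y ≡ true

data Walk {n : ℕ} (G : Graph n) : Fin n → Fin n → ℕ → Set where
  here : ∀ {x} → Walk G x x 0
  step : ∀ {x y z ℓ} → Adj G x y → Walk G y z ℓ → Walk G x z (suc ℓ)

Connected : ∀ {n} → Graph n → Set
Connected G = ∀ x y → ∃ λ ℓ → Walk G x y ℓ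

IsDist : ∀ {n} → Graph n → Fin n → Fin n → ℕ → Set
IsDist G x y d = Walk G x y d × (∀ ℓ → Walk G x y ℓ → d ≤ ℓ)

Bipartite : ∀ {n} → Graph n → Set
Bipartite {n} G = Σ (Fin n → Bool) λ col → ∀ x y → Adj G x y → col x ≢ col y

next : ∀ {k} → Fin (suc k) → Fin (suc k)
next {k} i with suc (toℕ i) <? suc k
... | yes p = fromℕ< p
... | no _  = fzero

record Cycle {n : ℕ} (G : Graph n) : Set where
  field
    len  : ℕ
    vert : Fin (suc (suc (suc len))) → Fin n
    inj  : ∀ i j → vert i ≡ vert j → i ≡ j
    cyc  : ∀ i → Adj G (vert i) (vert (next i))

open Cycle public

OnCycle : ∀ {n} {G : Graph n} → Cycle G → Fin n → Set
OnCycle C x = ∃ λ i → vert C i ≡ x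

EdgeOf : ∀ {n} {G : Graph n} → Cycle G → Fin n → Fin n → Set
EdgeOf C a b = ∃ λ i → (vert C i ≡ a × vert C (next i) ≡ b) ⊎ (vert C i ≡ b × vert C (next i) ≡ a)

-- Two cycles are the same (as subgraphs) iff they have the same edge set.
SameCycle : ∀ {n} {G : Graph n} → Cycle G → Cycle G → Set
SameCycle C D = ∀ a b → (EdgeOf C a b → EdgeOf D a b) × (EdgeOf D a b → EdgeOf C a b)

Cactus : ∀ {n} → Graph n → Set
Cactus G = Connected G ×
  (∀ (C D : Cycle G) → ¬ SameCycle C D →
     ∀ x y → OnCycle C x → OnCycle D x → OnCycle C y → OnCycle D y → x ≡ y)

IsEcc : ∀ {n} → Graph n → Fin n → ℕ → Set
IsEcc G v k = (∃ λ w → IsDist G v w k) × (∀ u d → IsDist G v u d → d ≤ k)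

-- Two distinct vertices a, b on the same level V_j are joined by a path whose inner
-- vertices all lie strictly below level j: follow geodesics from a and from b towards
-- v until they meet.  Any vertex above level j adjacent to both a and b closes this
-- path into a cycle.  In each forbidden configuration (three parents of one vertex;
-- two siblings of x; a sibling of x together with two parents of x) one obtains two
-- such cycles sharing two vertices, one of them containing a vertex that the other
-- misses, which a cactus does not allow.
module Submission where

open import Defs hiding (sym)
open import Data.Empty using (⊥; ⊥-elim)
open import Data.Fin using (Fin; zero; suc; toℕ; fromℕ; inject₁)
open import Data.Fin.Properties using (toℕ-injective; toℕ-fromℕ; toℕ-fromℕ<; toℕ-inject₁; toℕ<n; _≟_)
open import Data.List using (List; []; _∷_; _++_; [_]; length; lookup)
open import Data.List.Membership.Propositional using (_∈_; _∉_)
open import Data.List.Membership.Propositional.Properties using (∈-lookup; ∈-++⁻)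
import Data.List.Membership.DecPropositional as DecMembership
open import Data.List.Relation.Unary.All as All using ([]; _∷_)
open import Data.List.Relation.Unary.All.Properties using (¬Any⇒All¬)
open import Data.List.Relation.Unary.AllPairs using ([]; _∷_)
open import Data.List.Relation.Unary.Any using (here; there; index)
open import Data.List.Relation.Unary.Any.Properties using (lookup-index)
open import Data.List.Relation.Unary.Unique.Propositional using (Unique)
open import Data.List.Relation.Unary.Unique.Propositional.Properties using (++⁺)
open import Data.Nat using (ℕ; zero; suc; _≤_; _<_; _∸_; _+_; s≤s; z≤n; _<?_)
open import Data.Nat.Properties using (≤-antisym; ≤-pred; <-irrefl; <⇒≢; <-trans; n<1+n; n≤1+n; 1+n≢n; +-comm)
open import Data.Product using (Σ; ∃; _×_; _,_; proj₂)
open import Data.Sum using (_⊎_; inj₁; inj₂)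
open import Function.Bundles using (_⇔_; mk⇔; Equivalence)
open import Relation.Binary.Definitions using (DecidableEquality)
open import Relation.Binary.PropositionalEquality
  using (_≡_; _≢_; refl; sym; trans; cong; subst; ≢-sym)
open import Relation.Nullary using (yes; no)
open import Relation.Nullary.Decidable using (decidable-stable)

some-equal : ∀ {A : Set} → DecidableEquality A → (a b c : A) →
             (a ≢ b → a ≢ c → b ≢ c → ⊥) → a ≡ b ⊎ a ≡ c ⊎ b ≡ c
some-equal _≟_ a b c not-distinct with a ≟ b | a ≟ c | b ≟ c
... | yes a≡b | _       | _       = inj₁ a≡b
... | no _    | yes a≡c | _       = inj₂ (inj₁ a≡c)
... | no _    | no _    | yes b≡c = inj₂ (inj₂ b≡c)
... | no a≢b  | no a≢c  | no b≢c  = ⊥-elim (not-distinct a≢b a≢c b≢c)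

lookup-injective : ∀ {A : Set} {xs : List A} → Unique xs →
                   ∀ i j → lookup xs i ≡ lookup xs j → i ≡ j
lookup-injective (_ ∷ _)         zero    zero    _ = refl
lookup-injective (x≢xs ∷ _)      zero    (suc j) e = ⊥-elim (All.lookup x≢xs (∈-lookup j) e)
lookup-injective (x≢xs ∷ _)      (suc i) zero    e = ⊥-elim (All.lookup x≢xs (∈-lookup i) (sym e))
lookup-injective (_ ∷ unique-xs) (suc i) (suc j) e = cong suc (lookup-injective unique-xs i j e)

data LastOrInject₁ : ∀ {m} → Fin (suc m) → Set where
  last   : ∀ {m} → LastOrInject₁ (fromℕ m)
  inject : ∀ {m} (j : Fin m) → LastOrInject₁ (inject₁ j)

last-or-inject₁ : ∀ {m} (i : Fin (suc m)) → LastOrInject₁ i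
last-or-inject₁ {zero}  zero    = last
last-or-inject₁ {suc m} zero    = inject zero
last-or-inject₁ {suc m} (suc i) with last-or-inject₁ i
... | last     = last
... | inject j = inject (suc j)

next-fromℕ : ∀ m → next (fromℕ m) ≡ zero
next-fromℕ m with suc (toℕ (fromℕ m)) <? suc m
... | yes lt = ⊥-elim (<-irrefl refl (subst (λ t → suc t < suc m) (toℕ-fromℕ m) lt))
... | no _   = refl

next-inject₁ : ∀ {m} (j : Fin m) → next (inject₁ j) ≡ suc j
next-inject₁ {m} j with suc (toℕ (inject₁ j)) <? suc m
... | yes lt = toℕ-injective (trans (toℕ-fromℕ< lt) (cong suc (toℕ-inject₁ j)))
... | no ¬lt = ⊥-elim (¬lt (s≤s (subst (_< m) (sym (toℕ-inject₁ j)) (toℕ<n j))))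

module Layers {n : ℕ} (G : Graph n) (v : Fin n) where

  open DecMembership (_≟_ {n}) using (_∈?_)

  adj-sym : ∀ {x y} → Adj G x y → Adj G y x
  adj-sym {x} {y} = trans (Graph.sym G y x)

  snoc : ∀ {x y z ℓ} → Walk G x y ℓ → Adj G y z → Walk G x z (suc ℓ)
  snoc here         yz = step yz here
  snoc (step xw w)  yz = step xw (snoc w yz)

  unsnoc : ∀ {x z ℓ} → Walk G x z (suc ℓ) → ∃ λ y → Walk G x y ℓ × Adj G y z
  unsnoc (step xz here) = _ , here , xz
  unsnoc (step xw w@(step _ _)) with unsnoc w
  ... | y , w′ , yz = y , step xw w′ , yz

  Depth : Fin n → ℕ → Set
  Depth = IsDist G v

  depth-unique : ∀ {x d e} → Depth x d → Depth x e → d ≡ e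
  depth-unique (w , minimal) (w′ , minimal′) = ≤-antisym (minimal _ w′) (minimal′ _ w)

  depth-distinct : ∀ {x y d e} → Depth x d → Depth y e → d ≢ e → x ≢ y
  depth-distinct dx dy d≢e refl = d≢e (depth-unique dx dy)

  parent : ∀ {x j} → Depth x (suc j) → ∃ λ y → Adj G x y × Depth y j
  parent (w , minimal) with unsnoc w
  ... | y , w′ , yx = y , adj-sym yx , w′ , λ ℓ w″ → ≤-pred (minimal (suc ℓ) (snoc w″ yx))

  Shallower : Fin n → ℕ → Set
  Shallower u j = ∃ λ d → d < j × Depth u d

  data Geodesic : Fin n → ℕ → Set where
    root : Geodesic v 0
    down : ∀ {x y j} → Adj G x y → Depth x (suc j) → Geodesic y j → Geodesic x (suc j)

  geodesic : ∀ j {x} → Depth x j → Geodesic x j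
  geodesic zero    (here , _) = root
  geodesic (suc j) dx with parent dx
  ... | y , xy , dy = down xy dx (geodesic j dy)

  geodesic-depth : ∀ {x j} → Geodesic x j → Depth x j
  geodesic-depth root         = here , λ _ _ → z≤n
  geodesic-depth (down _ d _) = d

  -- The root has no successor; it is sent to itself.
  first-step : ∀ {x j} → Geodesic x j → Fin n
  first-step root                 = v
  first-step (down {y = y} _ _ _) = y

  first-step-depth : ∀ {x j} (g : Geodesic x (suc j)) → Depth (first-step g) j
  first-step-depth (down _ _ g) = geodesic-depth g

  -- Path x y L: a walk from x to y whose vertices after x are listed in L.
  data Path : Fin n → Fin n → List (Fin n) → Set where
    []  : ∀ {x} → Path x x []
    _∷_ : ∀ {x w y L} → Adj G x w → Path w y L → Path x y (w ∷ L)

  path-snoc : ∀ {x y z L} → Path x y L → Adj G y z → Path x z (L ++ [ z ])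
  path-snoc []       yz = yz ∷ []
  path-snoc (xw ∷ p) yz = xw ∷ path-snoc p yz

  path-end∈ : ∀ {x y L} → Path x y L → y ∈ x ∷ L
  path-end∈ []      = here refl
  path-end∈ (_ ∷ p) = there (path-end∈ p)

  path-nonempty : ∀ {x y L} → Path x y L → x ≢ y → 1 ≤ length L
  path-nonempty []      x≢x = ⊥-elim (x≢x refl)
  path-nonempty (_ ∷ _) _   = s≤s z≤n

  path-adj : ∀ {x y L} → Path x y L → (j : Fin (length L)) →
             Adj G (lookup (x ∷ L) (inject₁ j)) (lookup L j)
  path-adj (xw ∷ _) zero    = xw
  path-adj (_ ∷ p)  (suc j) = path-adj p j

  path-end : ∀ {x y L} → Path x y L → lookup (x ∷ L) (fromℕ (length L)) ≡ y
  path-end []      = refl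
  path-end (_ ∷ p) = path-end p

  CycleOn : List (Fin n) → Set
  CycleOn L = Σ (Cycle G) λ C → ∀ {u} → OnCycle C u ⇔ u ∈ L

  closed-path-cycle : ∀ {z y L} → Path z y L → Adj G y z → Unique (z ∷ L) → 2 ≤ length L →
                      CycleOn (z ∷ L)
  closed-path-cycle {L = []}    _ _ _ ()
  closed-path-cycle {L = _ ∷ []} _ _ _ (s≤s ())
  closed-path-cycle {z} {y} {L@(_ ∷ _ ∷ rest)} p yz unique _ =
    record { len = length rest ; vert = lookup (z ∷ L) ; inj = lookup-injective unique ; cyc = closing }
    , mk⇔ (λ (i , e) → subst (_∈ z ∷ L) e (∈-lookup i)) (λ m → index m , sym (lookup-index m))
    where
    closing : ∀ i → Adj G (lookup (z ∷ L) i) (lookup (z ∷ L) (next i))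
    closing i with last-or-inject₁ i
    ... | last     rewrite next-fromℕ (length L) | path-end p = yz
    ... | inject j rewrite next-inject₁ j = path-adj p j

  same-cycle-vertex : ∀ {C D : Cycle G} {w} → SameCycle C D → OnCycle D w → OnCycle C w
  same-cycle-vertex same (i , refl) with proj₂ (same _ _) (i , inj₁ (refl , refl))
  ... | j , inj₁ (e , _) = j , e
  ... | j , inj₂ (_ , e) = next j , e

  cactus-overlap : Cactus G → ∀ {X Y x y} → CycleOn X → CycleOn Y → x ≢ y →
                   x ∈ X → x ∈ Y → y ∈ X → y ∈ Y → ∀ {w} → w ∈ Y → w ∈ X
  cactus-overlap (_ , share≤1) {X} {x = x} {y} (C , on-C) (D , on-D) x≢y xX xY yX yY {w} wY =
    decidable-stable (w ∈? X) λ w∉X →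
      x≢y (share≤1 C D (λ same → w∉X (to on-C (same-cycle-vertex {C} {D} same (from on-D wY))))
                   x y (from on-C xX) (from on-D xY) (from on-C yX) (from on-D yY))
    where open Equivalence

  record PathBelow (a b : Fin n) (j : ℕ) (s : Fin n) : Set where
    field
      route   : List (Fin n)
      path    : Path a b route
      unique  : Unique (a ∷ route)
      inner   : ∀ {u} → u ∈ route → u ≡ b ⊎ Shallower u j
      through : s ∈ route

  open PathBelow

  deeper∉ : ∀ {a b j s x e} (V : PathBelow a b j s) → Depth a j → Depth b j →
            Depth x e → j < e → x ∉ a ∷ route V
  deeper∉ V da db dx j<e (here refl) = <⇒≢ j<e (depth-unique da dx)
  deeper∉ V da db dx j<e (there m) with inner V m
  ... | inj₁ refl           = <⇒≢ j<e (depth-unique db dx)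
  ... | inj₂ (d , d<j , dd) = <⇒≢ (<-trans d<j j<e) (depth-unique dd dx)

  common-parent-path : ∀ {a b c j} → Adj G a c → Adj G b c → Depth a (suc j) → Depth b (suc j) →
                       Depth c j → a ≢ b → PathBelow a b (suc j) c
  common-parent-path {j = j} ac bc da db dc a≢b = record
    { route   = _ ∷ _ ∷ []
    ; path    = ac ∷ (adj-sym bc ∷ [])
    ; unique  = (a≢c ∷ a≢b ∷ []) ∷ (≢-sym b≢c ∷ []) ∷ [] ∷ []
    ; inner   = λ { (here refl) → inj₂ (j , n<1+n j , dc)
                  ; (there (here refl)) → inj₁ refl
                  ; (there (there ())) }
    ; through = here refl
    }
    where
    a≢c = depth-distinct da dc 1+n≢n
    b≢c = depth-distinct db dc 1+n≢n

  extend-below : ∀ {a b a′ b′ j s} → Adj G a a′ → Adj G b b′ →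
                 Depth a (suc j) → Depth b (suc j) → Depth a′ j → Depth b′ j →
                 a ≢ b → PathBelow a′ b′ j s → PathBelow a b (suc j) a′
  extend-below {a} {b} {a′} {j = j} aa′ bb′ da db da′ db′ a≢b V = record
    { route   = a′ ∷ route V ++ [ b ]
    ; path    = aa′ ∷ path-snoc (path V) (adj-sym bb′)
    ; unique  = ¬Any⇒All¬ _ a∉ ∷ ++⁺ (unique V) ([] ∷ []) λ { (bV , here refl) → b∉V bV }
    ; inner   = inner′
    ; through = here refl
    }
    where
    b∉V : b ∉ a′ ∷ route V
    b∉V = deeper∉ V da′ db′ db (n<1+n j)
    a∉ : a ∉ a′ ∷ route V ++ [ b ]
    a∉ m with ∈-++⁻ (a′ ∷ route V) m
    ... | inj₁ aV        = deeper∉ V da′ db′ da (n<1+n j) aV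
    ... | inj₂ (here a≡b) = a≢b a≡b
    inner′ : ∀ {u} → u ∈ a′ ∷ route V ++ [ b ] → u ≡ b ⊎ Shallower u (suc j)
    inner′ m with ∈-++⁻ (a′ ∷ route V) m
    ... | inj₁ (here refl) = inj₂ (j , n<1+n j , da′)
    ... | inj₁ (there uV) with inner V uV
    ...   | inj₁ refl           = inj₂ (j , n<1+n j , db′)
    ...   | inj₂ (d , d<j , dd) = inj₂ (d , <-trans d<j (n<1+n j) , dd)
    inner′ m | inj₂ (here u≡b) = inj₁ u≡b

  path-below : ∀ {a b j} (ga : Geodesic a j) → Geodesic b j → a ≢ b →
               PathBelow a b j (first-step ga)
  path-below root root a≢b = ⊥-elim (a≢b refl)
  path-below (down {y = a′} aa′ da ga) (down {y = b′} bb′ db gb) a≢b with a′ ≟ b′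
  ... | yes refl  = common-parent-path aa′ bb′ da db (geodesic-depth ga) a≢b
  ... | no a′≢b′ = extend-below aa′ bb′ da db (geodesic-depth ga) (geodesic-depth gb) a≢b
                                (path-below ga gb a′≢b′)

  apex-cycle : ∀ {a b j s z e} (V : PathBelow a b j s) → Depth a j → Depth b j → a ≢ b →
               Adj G z a → Adj G b z → Depth z e → j < e → CycleOn (z ∷ a ∷ route V)
  apex-cycle V da db a≢b za bz dz j<e =
    closed-path-cycle (za ∷ path V) bz (¬Any⇒All¬ _ (deeper∉ V da db dz j<e) ∷ unique V)
                      (s≤s (path-nonempty (path V) a≢b))

  at-most-two-parents : Cactus G → ∀ {x a b c j} → Depth x (suc j) →
                        Adj G x a → Adj G x b → Adj G x c → Depth a j → Depth b j → Depth c j →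
                        a ≢ b → a ≢ c → b ≢ c → ⊥
  at-most-two-parents cactus {x} {a} {b} {c} dx xa xb xc da db dc a≢b a≢c b≢c =
    c∉X (cactus-overlap cactus X Y (depth-distinct dx da 1+n≢n)
           (here refl) (here refl) (there (here refl)) (there (here refl))
           (there (path-end∈ (path V₂))))
    where
    ga = geodesic _ da
    V₁ = path-below ga (geodesic _ db) a≢b
    V₂ = path-below ga (geodesic _ dc) a≢c
    X = apex-cycle V₁ da db a≢b xa (adj-sym xb) dx (n<1+n _)
    Y = apex-cycle V₂ da dc a≢c xa (adj-sym xc) dx (n<1+n _)
    c∉X : c ∉ x ∷ a ∷ route V₁
    c∉X (here c≡x)         = depth-distinct dc dx (≢-sym 1+n≢n) c≡x
    c∉X (there (here c≡a)) = a≢c (sym c≡a)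
    c∉X (there (there m)) with inner V₁ m
    ... | inj₁ c≡b            = b≢c (sym c≡b)
    ... | inj₂ (d , d<j , dd) = <⇒≢ d<j (depth-unique dd dc)

  at-most-one-sibling : Cactus G → ∀ {x y₁ y₂ z₁ z₂ i} →
                        Depth x (suc i) → Depth y₁ (suc i) → Depth y₂ (suc i) → y₁ ≢ x → y₂ ≢ x →
                        Depth z₁ (suc (suc i)) → Adj G x z₁ → Adj G y₁ z₁ →
                        Depth z₂ (suc (suc i)) → Adj G x z₂ → Adj G y₂ z₂ → y₁ ≡ y₂
  at-most-one-sibling cactus {x} {y₁} {y₂} {z₁} {z₂} dx dy₁ dy₂ y₁≢x y₂≢x dz₁ xz₁ y₁z₁ dz₂ xz₂ y₂z₂
    with y₁ ≟ y₂ | z₁ ≟ z₂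
  ... | yes y₁≡y₂ | _ = y₁≡y₂
  ... | no y₁≢y₂ | yes refl =
    ⊥-elim (at-most-two-parents cactus dz₁ (adj-sym xz₁) (adj-sym y₁z₁) (adj-sym y₂z₂) dx dy₁ dy₂
                                (≢-sym y₁≢x) (≢-sym y₂≢x) y₁≢y₂)
  ... | no _ | no z₁≢z₂ =
    ⊥-elim (z₂∉X (cactus-overlap cactus X Y (depth-distinct dx (first-step-depth gx) 1+n≢n)
                   (there (here refl)) (there (here refl))
                   (there (there (through V₁))) (there (there (through V₂))) (here refl)))
    where
    gx = geodesic _ dx
    V₁ = path-below gx (geodesic _ dy₁) (≢-sym y₁≢x)
    V₂ = path-below gx (geodesic _ dy₂) (≢-sym y₂≢x)
    X = apex-cycle V₁ dx dy₁ (≢-sym y₁≢x) (adj-sym xz₁) y₁z₁ dz₁ (n<1+n _)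
    Y = apex-cycle V₂ dx dy₂ (≢-sym y₂≢x) (adj-sym xz₂) y₂z₂ dz₂ (n<1+n _)
    z₂∉X : z₂ ∉ z₁ ∷ x ∷ route V₁
    z₂∉X (here z₂≡z₁) = z₁≢z₂ (sym z₂≡z₁)
    z₂∉X (there m)    = deeper∉ V₁ dx dy₁ dz₂ (n<1+n _) m

  sibling⇒unique-parent : Cactus G → ∀ {x y z a b i} →
                          Depth x (suc i) → Depth y (suc i) → y ≢ x →
                          Depth z (suc (suc i)) → Adj G x z → Adj G y z →
                          Adj G x a → Depth a i → Adj G x b → Depth b i → a ≡ b
  sibling⇒unique-parent cactus {x} {y} {z} {a} {b} {i} dx dy y≢x dz xz yz xa da xb db with a ≟ b
  ... | yes a≡b = a≡b
  ... | no a≢b =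
    ⊥-elim (z∉X (cactus-overlap cactus X Y (depth-distinct dx da 1+n≢n)
                  (here refl) (there (here refl))
                  (there (here refl)) (there (there (through V₂))) (here refl)))
    where
    ga = geodesic i da
    V₁ = path-below ga (geodesic i db) a≢b
    V₂ = path-below (down xa dx ga) (geodesic _ dy) (≢-sym y≢x)
    X = apex-cycle V₁ da db a≢b xa (adj-sym xb) dx (n<1+n i)
    Y = apex-cycle V₂ dx dy (≢-sym y≢x) (adj-sym xz) yz dz (n<1+n _)
    z∉X : z ∉ x ∷ a ∷ route V₁
    z∉X (here z≡x) = depth-distinct dz dx 1+n≢n z≡x
    z∉X (there m)  = deeper∉ V₁ da db dz (s≤s (n≤1+n i)) m

mainTheorem12 : ∀ {n} (G : Graph n) → Bipartite G → Cactus G →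
    ∀ (v : Fin n) (k : ℕ) → IsEcc G v k →
    (∀ i x → 1 ≤ i → i ≤ k → IsDist G v x i →
       ∀ a b c → Adj G x a → Adj G x b → Adj G x c →
       IsDist G v a (i ∸ 1) → IsDist G v b (i ∸ 1) → IsDist G v c (i ∸ 1) →
       a ≡ b ⊎ a ≡ c ⊎ b ≡ c)
    ×
    (∀ i x → 1 ≤ i → i ≤ k ∸ 1 → IsDist G v x i →
       (∀ y₁ y₂ → IsDist G v y₁ i → y₁ ≢ x → IsDist G v y₂ i → y₂ ≢ x →
          (∃ λ z → IsDist G v z (i + 1) × Adj G x z × Adj G y₁ z) →
          (∃ λ z → IsDist G v z (i + 1) × Adj G x z × Adj G y₂ z) →
          y₁ ≡ y₂)
       ×
       ((∃ λ y → IsDist G v y i × y ≢ x ×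
           (∃ λ z → IsDist G v z (i + 1) × Adj G x z × Adj G y z)) →
          (∃ λ a → Adj G x a × IsDist G v a (i ∸ 1)) ×
          (∀ a b → Adj G x a → IsDist G v a (i ∸ 1) →
                   Adj G x b → IsDist G v b (i ∸ 1) → a ≡ b)))
mainTheorem12 G _ cactus v _ _ =
  (λ where
    zero    _ () _ _
    (suc i) x _ _ dx a b c xa xb xc da db dc →
      some-equal _≟_ a b c (at-most-two-parents cactus dx xa xb xc da db dc)) ,
  (λ where
    zero    _ () _ _
    (suc i) x _ _ dx →
      (λ { _ _ dy₁ y₁≢x dy₂ y₂≢x (_ , dz₁ , xz₁ , y₁z₁) (_ , dz₂ , xz₂ , y₂z₂) →
             at-most-one-sibling cactus dx dy₁ dy₂ y₁≢x y₂≢x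
               (depth-suc dz₁) xz₁ y₁z₁ (depth-suc dz₂) xz₂ y₂z₂ }) ,
      λ { (_ , dy , y≢x , _ , dz , xz , yz) →
            parent dx ,
            λ a b xa da xb db → sibling⇒unique-parent cactus dx dy y≢x (depth-suc dz) xz yz xa da xb db })
  where
  open Layers G v
  depth-suc : ∀ {z j} → Depth z (j + 1) → Depth z (suc j)
  depth-suc {z} {j} = subst (Depth z) (+-comm j 1)
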